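{- Let $(G,\omega)$, $v_0$, $u_{\max}\ne v_0$ and $L(G)$ be as in the context. Every vertex $v$ such that $L_{v_0,v}\cap L(G)=\emptyset$ satisfies $\mathrm{ecc}_{(G,\omega)}(v)=d(v,v_0)+d_\omega(v_0,u_{\max})=d_\omega(v,u_{\max})$.
   Context: Graphs are finite, simple, undirected, connected; $d$ is shortest-path distance; $\log$ is the natural logarithm. A graph is median if for every triple of distinct vertices $x,y,z$, $I(x,y)\cap I(y,z)\cap I(z,x)$ is a single vertex, where $I(u,v)=\{x:d(u,x)+d(x,v)=d(u,v)\}$. $\Theta$-classes: edges $uv,xy$ are $\Theta_0$-related if $uvyx$ is a 4-cycle with $uv,xy$ opposite; $\Theta$ is the reflexive-transitive closure; removing a $\Theta$-class from a median graph leaves two components, its halfspaces. A $\Theta$-class separates $u$ and $v$ if they lie in different halfspaces of it. The ladder set $L_{u,v}$ is the set of $\Theta$-classes that separate $u$ and $v$ and contain an edge incident to $u$. For $\omega:V\to\mathbb{N}$, $d_\omega(u,v)=d(u,v)+\omega(v)$ and $\mathrm{ecc}_{(G,\omega)}(u)=\max_v d_\omega(u,v)$. Setting: $(G,\omega)$ is a weighted median graph with $n=|V(G)|\ge3$ in which every $\Theta$-class has a halfspace (its minority halfspace) of size $<n/(2\log n)$; $v_0$ is the unique vertex belonging to every majority (larger) halfspace. $u_{\max}$ is a vertex maximizing $d_\omega(v_0,\cdot)$, chosen equal to $v_0$ whenever $v_0$ is a maximizer, and it is assumed that $u_{\max}\neq v_0$. $L(G)=L_{v_0,u_{\max}}$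 (the wide ladder). -}

module Defs where

open import Data.Nat using (ℕ; zero; suc; _+_; _*_; _^_; _≤_; _<_; _⊔_; _!)

open import Data.Fin using (Fin)
open import Data.Fin.Subset using (Subset; _∈_; ∣_∣)
open import Data.List using (foldr; map; allFin)
open import Data.Product using (Σ; _×_; _,_)
open import Data.Sum using (_⊎_)
open import Data.Empty using (⊥)
open import Relation.Nullary using (¬_)
open import Relation.Binary.PropositionalEquality using (_≡_; _≢_)
open import Relation.Binary.Construct.Closure.ReflexiveTransitive using (Star)
open import Function.Bundles using (_⇔_)

Rel : ℕ → Set₁
Rel n = Fin n → Fin n → Set

IsSimple : ∀ {n} → Rel n → Set
IsSimple {n} Adj = (∀ u v → Adj u v → Adj v u) × (∀ u → ¬ Adj u u)

data Walk {n : ℕ} (Adj : Rel n) : ℕ → Fin n → Fin n → Set where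
  here : ∀ {u} → Walk Adj 0 u u
  step : ∀ {k u w v} → Adj u w → Walk Adj k w v → Walk Adj (suc k) u v

-- d is the shortest-path distance of the graph (this also forces connectivity)
IsShortestPathDist : ∀ {n} → Rel n → (Fin n → Fin n → ℕ) → Set
IsShortestPathDist Adj d =
  ∀ u v → Walk Adj (d u v) u v × (∀ k → Walk Adj k u v → d u v ≤ k)

InI : ∀ {n} → (Fin n → Fin n → ℕ) → Fin n → Fin n → Fin n → Set
InI d u v x = d u x + d x v ≡ d u v

IsMedian : ∀ {n} → (Fin n → Fin n → ℕ) → Set
IsMedian {n} d = ∀ x y z → x ≢ y → y ≢ z → x ≢ z →
  Σ (Fin n) λ m → (InI d x y m × InI d y z m × InI d z x m) ×
    (∀ m′ → InI d x y m′ → InI d y z m′ → InI d z x m′ → m′ ≡ m)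

Edge : ℕ → Set
Edge n = Fin n × Fin n

swap : ∀ {n} → Edge n → Edge n
swap (u , v) = v , u

-- Θ₀: uv and xy are opposite edges of the 4-cycle u v y x
Θ₀ : ∀ {n} → Rel n → Edge n → Edge n → Set
Θ₀ Adj (u , v) (x , y) =
  Adj u v × Adj v y × Adj y x × Adj x u × u ≢ y × v ≢ x

-- one step of the (symmetric) relation on unordered edges
ΘStep : ∀ {n} → Rel n → Edge n → Edge n → Set
ΘStep Adj e f = Θ₀ Adj e f ⊎ Θ₀ Adj f e ⊎ f ≡ swap e

Θ : ∀ {n} → Rel n → Edge n → Edge n → Set
Θ Adj = Star (ΘStep Adj)

ConnAvoid : ∀ {n} → Rel n → Edge n → Fin n → Fin n → Set
ConnAvoid Adj e = Star (λ x y → Adj x y × ¬ Θ Adj e (x , y))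

Separates : ∀ {n} → Rel n → Edge n → Fin n → Fin n → Set
Separates Adj e u v = ¬ ConnAvoid Adj e u v

HalfSize : ∀ {n} → Rel n → Edge n → Fin n → ℕ → Set
HalfSize {n} Adj e c h =
  Σ (Subset n) λ S → (∀ x → (x ∈ S) ⇔ ConnAvoid Adj e c x) × ∣ S ∣ ≡ h

-- expPartial x K = Σ_{k=0}^{K} x^k · K!/k!   (so expPartial x K / K! → e^x)
expPartial : ℕ → ℕ → ℕ
expPartial x zero = 1
expPartial x (suc K) = suc K * expPartial x K + x ^ suc K

-- Small n h  ⇔  h < n / (2 log n)  (for n ≥ 2)  ⇔  n^(2h) < e^n
--            ⇔  ∃ K. n^(2h) < Σ_{k≤K} n^k / k!
Small : ℕ → ℕ → Set
Small n h = Σ ℕ λ K → n ^ (2 * h) * K ! < expPartial n K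

MinorityCondition : ∀ {n} → Rel n → Set
MinorityCondition {n} Adj = ∀ a b → Adj a b →
  Σ (Fin n) λ c → (c ≡ a ⊎ c ≡ b) × Σ ℕ λ h → HalfSize Adj (a , b) c h × Small n h

InAllMajority : ∀ {n} → Rel n → Fin n → Set
InAllMajority Adj v0 = ∀ a b → Adj a b → ∀ ha hb →
  HalfSize Adj (a , b) a ha → HalfSize Adj (a , b) b hb → ha < hb →
  ConnAvoid Adj (a , b) b v0

dω : ∀ {n} → (Fin n → Fin n → ℕ) → (Fin n → ℕ) → Fin n → Fin n → ℕ
dω d ω u v = d u v + ω v

ecc : ∀ {n} → (Fin n → Fin n → ℕ) → (Fin n → ℕ) → Fin n → ℕ
ecc {n} d ω u = foldr _⊔_ 0 (map (dω d ω u) (allFin n))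

InLadder : ∀ {n} → Rel n → Edge n → Fin n → Fin n → Set
InLadder {n} Adj e u v =
  Separates Adj e u v × Σ (Fin n) λ w → Adj u w × Θ Adj e (u , w)

{-# OPTIONS --safe #-}
-- Let m be the median of v0, v and umax. If m ≠ v0, the first edge v0w of a geodesic from v0
-- to m has w closer than v0 to both v and umax. In a median graph every edge pq with
-- d(p,a) < d(p,b) and d(q,a) > d(q,b) is Θ-related to ab, so the Θ-class of v0w separates v0
-- from both v and umax and lies in both ladder sets. Hence v0 ∈ I(v,umax); the triangle
-- inequality through v0 bounds ecc(v) by d(v,v0) + dω(v0,umax), and umax attains the bound.
module Submission where

open import Defs
open import Data.Nat using (ℕ; zero; suc; _+_; _≤_; _<_; _⊔_; z≤n; z<s; _<?_)
open import Data.Nat.Properties hiding (_≟_)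
open import Data.Fin using (Fin; _≟_)
open import Data.Product using (Σ; _×_; _,_)
open import Data.Sum using (_⊎_; inj₁; inj₂)
open import Data.Empty using (⊥; ⊥-elim)
open import Data.List using (List; []; _∷_; foldr; map; allFin)
open import Data.List.Membership.Propositional using (_∈_)
open import Data.List.Membership.Propositional.Properties using (∈-allFin)
open import Data.List.Relation.Unary.Any using (here; there)
open import Relation.Nullary using (¬_; yes; no)
open import Relation.Binary.PropositionalEquality
  using (_≡_; _≢_; refl; sym; trans; cong; cong₂; subst; subst₂; module ≡-Reasoning)
open import Relation.Binary.Construct.Closure.ReflexiveTransitive using (ε; _◅_; _◅◅_)

foldr-⊔-lub : ∀ {A : Set} {B : ℕ} (f : A → ℕ) (xs : List A) →
              (∀ x → f x ≤ B) → foldr _⊔_ 0 (map f xs) ≤ B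
foldr-⊔-lub f []       f≤B = z≤n
foldr-⊔-lub f (x ∷ xs) f≤B = ⊔-lub (f≤B x) (foldr-⊔-lub f xs f≤B)

≤-foldr-⊔ : ∀ {A : Set} (f : A → ℕ) {xs : List A} {y : A} →
            y ∈ xs → f y ≤ foldr _⊔_ 0 (map f xs)
≤-foldr-⊔ f {x ∷ _} (here refl) = m≤m⊔n (f x) _
≤-foldr-⊔ f {x ∷ _} (there y∈xs) = m≤n⇒m≤o⊔n (f x) (≤-foldr-⊔ f y∈xs)

n+n≡2⇒n≡1 : ∀ n → n + n ≡ 2 → n ≡ 1
n+n≡2⇒n≡1 (suc zero)    _  = refl
n+n≡2⇒n≡1 (suc (suc n)) eq = ⊥-elim (m+1+n≢0 n (suc-injective (suc-injective eq)))

module ShortestPaths {n : ℕ} (Adj : Rel n) (simple : IsSimple Adj)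
                     (d : Fin n → Fin n → ℕ) (shortest : IsShortestPathDist Adj d) where

  private variable
    k l : ℕ
    m u v w x y : Fin n

  adj-sym : Adj u v → Adj v u
  adj-sym {u} {v} = let (symmetric , _) = simple in symmetric u v

  _++ʷ_ : Walk Adj k u w → Walk Adj l w v → Walk Adj (k + l) u v
  here       ++ʷ q = q
  step uw p  ++ʷ q = step uw (p ++ʷ q)

  reverseʷ : Walk Adj k u v → Walk Adj k v u
  reverseʷ here = here
  reverseʷ {suc k} {u} {v} (step uw p) =
    subst (λ j → Walk Adj j v u) (+-comm k 1) (reverseʷ p ++ʷ step (adj-sym uw) here)

  geodesic : ∀ u v → Walk Adj (d u v) u v
  geodesic u v = let (p , _) = shortest u v in p

  d-minimal : Walk Adj k u v → d u v ≤ k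
  d-minimal {k} {u} {v} = let (_ , minimal) = shortest u v in minimal k

  d-sym : ∀ u v → d u v ≡ d v u
  d-sym u v = ≤-antisym (d-minimal (reverseʷ (geodesic v u))) (d-minimal (reverseʷ (geodesic u v)))

  d-triangle : ∀ u w v → d u v ≤ d u w + d w v
  d-triangle u w v = d-minimal (geodesic u w ++ʷ geodesic w v)

  d-refl : ∀ u → d u u ≡ 0
  d-refl u = n≤0⇒n≡0 (d-minimal {0} here)

  d≡0⇒≡ : d u v ≡ 0 → u ≡ v
  d≡0⇒≡ {u} {v} eq with subst (λ j → Walk Adj j u v) eq (geodesic u v)
  ... | here = refl

  d≡1⇒adj : d u v ≡ 1 → Adj u v
  d≡1⇒adj {u} {v} eq with subst (λ j → Walk Adj j u v) eq (geodesic u v)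
  ... | step uv here = uv

  adj⇒d≡1 : Adj u v → d u v ≡ 1
  adj⇒d≡1 {u} {v} uv = ≤-antisym (d-minimal (step uv here)) (n≢0⇒n>0 d≢0)
    where
    d≢0 : d u v ≢ 0
    d≢0 eq = let (_ , irrefl) = simple in irrefl u (subst (Adj u) (sym (d≡0⇒≡ eq)) uv)

  d-stepˡ : Adj u w → ∀ x → d u x ≤ suc (d w x)
  d-stepˡ uw x = d-minimal (step uw (geodesic _ x))

  d-stepʳ : Adj u w → ∀ x → d x w ≤ suc (d x u)
  d-stepʳ {u} {w} uw x = subst₂ (λ s t → s ≤ suc t) (d-sym w x) (d-sym u x) (d-stepˡ (adj-sym uw) x)

  geodesic-next : d u v ≡ suc k → Σ (Fin n) λ w → Adj u w × d w v ≡ k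
  geodesic-next {u} {v} eq with subst (λ j → Walk Adj j u v) eq (geodesic u v)
  ... | step {w = w} uw rest =
    w , uw , ≤-antisym (d-minimal rest) (≤-pred (subst (_≤ suc (d w v)) eq (d-stepˡ uw v)))

  InI-sym : InI d x y v → InI d y x v
  InI-sym {x} {y} {v} between = begin
    d y v + d v x ≡⟨ +-comm (d y v) (d v x) ⟩
    d v x + d y v ≡⟨ cong₂ _+_ (d-sym v x) (d-sym y v) ⟩
    d x v + d v y ≡⟨ between ⟩
    d x y         ≡⟨ d-sym x y ⟩
    d y x         ∎
    where open ≡-Reasoning

  step-toward : u ≢ v → Σ (Fin n) λ w → Adj u w × d w v < d u v
  step-toward {u} {v} u≢v with d u v in uv
  ... | zero  = ⊥-elim (u≢v (d≡0⇒≡ uv))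
  ... | suc k = let (w , uw , wv) = geodesic-next uv in w , uw , ≤-reflexive (cong suc wv)

  closer-through-interval : InI d x v m → d w m < d v m → d x w < d x v
  closer-through-interval {x} {v} {m} {w} between w-closer = begin-strict
    d x w          ≤⟨ d-triangle x m w ⟩
    d x m + d m w  ≡⟨ cong (d x m +_) (d-sym m w) ⟩
    d x m + d w m  <⟨ +-monoʳ-< (d x m) w-closer ⟩
    d x m + d v m  ≡⟨ cong (d x m +_) (d-sym v m) ⟩
    d x m + d m v  ≡⟨ between ⟩
    d x v          ∎
    where open ≤-Reasoning

  dω-through : ∀ ω {v0 u v} → InI d v u v0 → d v v0 + dω d ω v0 u ≡ dω d ω v u
  dω-through ω {v0} {u} {v} between = begin
    d v v0 + (d v0 u + ω u) ≡⟨ +-assoc (d v v0) (d v0 u) (ω u) ⟨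
    d v v0 + d v0 u + ω u   ≡⟨ cong (_+ ω u) between ⟩
    d v u + ω u             ∎
    where open ≡-Reasoning

  ecc-through : ∀ ω {v0 u v} → (∀ x → dω d ω v0 x ≤ dω d ω v0 u) → InI d v u v0 →
                ecc d ω v ≡ d v v0 + dω d ω v0 u
  ecc-through ω {v0} {u} {v} u-max between = ≤-antisym ecc≤ ≤ecc
    where
    dω≤ : ∀ x → dω d ω v x ≤ d v v0 + dω d ω v0 u
    dω≤ x = begin
      d v x + ω x             ≤⟨ +-monoˡ-≤ (ω x) (d-triangle v v0 x) ⟩
      d v v0 + d v0 x + ω x   ≡⟨ +-assoc (d v v0) (d v0 x) (ω x) ⟩
      d v v0 + dω d ω v0 x    ≤⟨ +-monoʳ-≤ (d v v0) (u-max x) ⟩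
      d v v0 + dω d ω v0 u    ∎
      where open ≤-Reasoning
    ecc≤ : ecc d ω v ≤ d v v0 + dω d ω v0 u
    ecc≤ = foldr-⊔-lub (dω d ω v) (allFin n) dω≤
    ≤ecc : d v v0 + dω d ω v0 u ≤ ecc d ω v
    ≤ecc = subst (_≤ ecc d ω v) (sym (dω-through ω between)) (≤-foldr-⊔ (dω d ω v) (∈-allFin u))

module MedianGraphs {n : ℕ} (Adj : Rel n) (simple : IsSimple Adj)
                    (d : Fin n → Fin n → ℕ) (shortest : IsShortestPathDist Adj d)
                    (median : IsMedian d) where

  open ShortestPaths Adj simple d shortest public

  private variable
    k : ℕ
    a b c p q u v v0 x y z : Fin n

  InI-left : ∀ x y → InI d x y x
  InI-left x y = cong (_+ d x y) (d-refl x)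

  InI-right : ∀ x y → InI d x y y
  InI-right x y = trans (cong (d x y +_) (d-refl y)) (+-identityʳ (d x y))

  median-of : ∀ x y z → Σ (Fin n) λ m → InI d x y m × InI d y z m × InI d z x m
  median-of x y z with x ≟ y | y ≟ z | x ≟ z
  ... | yes refl | _        | _        = x , InI-left x x , InI-left x z , InI-right z x
  ... | no _     | yes refl | _        = y , InI-right x y , InI-left y y , InI-left y x
  ... | no _     | no _     | yes refl = x , InI-left x y , InI-right y x , InI-left x x
  ... | no x≢y   | no y≢z   | no x≢z   = let (m , intervals , _) = median x y z x≢y y≢z x≢z
                                         in m , intervals

  adj-interval⇒endpoint : Adj x y → InI d x y z → z ≡ x ⊎ z ≡ y
  adj-interval⇒endpoint {x} {y} {z} xy between with d x z in xz
  ... | zero  = inj₁ (sym (d≡0⇒≡ xz))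
  ... | suc j = inj₂ (d≡0⇒≡ (m+n≡0⇒n≡0 j (suc-injective (trans between (adj⇒d≡1 xy)))))

  adj-between⇒d≡suc : Adj x y → InI d y z x → d z y ≡ suc (d z x)
  adj-between⇒d≡suc {x} {y} {z} xy between = begin
    d z y         ≡⟨ d-sym z y ⟩
    d y z         ≡⟨ between ⟨
    d y x + d x z ≡⟨ cong₂ _+_ (adj⇒d≡1 (adj-sym xy)) (d-sym x z) ⟩
    suc (d z x)   ∎
    where open ≡-Reasoning

  adj⇒d≢ : Adj x y → ∀ z → d z x ≢ d z y
  adj⇒d≢ {x} {y} xy z eq with median-of z x y
  ... | m , zx , xy-m , yz with adj-interval⇒endpoint xy xy-m
  ... | inj₁ refl = 1+n≢n (trans (sym (adj-between⇒d≡suc xy yz)) (sym eq))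
  ... | inj₂ refl = 1+n≢n (trans (sym (adj-between⇒d≡suc (adj-sym xy) (InI-sym zx))) eq)

  closer⇒d≡suc : Adj a b → d x a < d x b → d x b ≡ suc (d x a)
  closer⇒d≡suc ab closer = ≤-antisym (d-stepʳ ab _) closer

  ≮⇒d≡suc : Adj a b → ¬ (d x a < d x b) → d x a ≡ suc (d x b)
  ≮⇒d≡suc {a} {b} {x} ab ≮ =
    closer⇒d≡suc (adj-sym ab) (≤∧≢⇒< (≮⇒≥ ≮) (λ eq → adj⇒d≢ ab x (sym eq)))

  common-neighbour : d x y ≡ 2 → d x c ≡ suc k → d y c ≡ suc k →
                     Σ (Fin n) λ m → (Adj x m × Adj m y) × d m c ≡ k
  common-neighbour {x} {y} {c} {k} xy xc yc with median-of x y c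
  ... | m , xym , ycm , cxm = m , (d≡1⇒adj xm≡1 , d≡1⇒adj my≡1) , mc≡k
    where
    my+mc : d m y + d m c ≡ suc k
    my+mc = trans (cong (_+ d m c) (d-sym m y)) (trans ycm yc)
    xm+mc : d x m + d m c ≡ suc k
    xm+mc = trans (+-comm (d x m) (d m c))
                  (trans (cong₂ _+_ (d-sym m c) (d-sym x m)) (trans cxm (trans (d-sym c x) xc)))
    my≡xm : d m y ≡ d x m
    my≡xm = +-cancelʳ-≡ (d m c) (d m y) (d x m) (trans my+mc (sym xm+mc))
    xm≡1 : d x m ≡ 1
    xm≡1 = n+n≡2⇒n≡1 (d x m) (trans (cong (d x m +_) (sym my≡xm)) (trans xym xy))
    my≡1 : d m y ≡ 1
    my≡1 = trans my≡xm xm≡1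
    mc≡k : d m c ≡ k
    mc≡k = suc-injective (trans (cong (_+ d m c) (sym my≡1)) my+mc)

  module _ {a b : Fin n} (ab : Adj a b) where

    -- Moving p one step towards a gives p′ with p′q at distance 2; the median of p′, q and b is
    -- a common neighbour m closing the square p′ m q p, and p′m is parallel to ab one level down.
    parallel⇒Θ : ∀ k {p q} → Adj p q → d p a ≡ k → d q b ≡ k → d p b ≡ suc k → d q a ≡ suc k →
                 Θ Adj (a , b) (p , q)
    parallel⇒Θ zero pq pa qb _ _ with d≡0⇒≡ pa | d≡0⇒≡ qb
    ... | refl | refl = ε
    parallel⇒Θ (suc k) {p} {q} pq pa qb pb qa with geodesic-next pa
    ... | p′ , pp′ , p′a =
      let (m , (p′m , mq) , mb) = common-neighbour p′q≡2 p′b qb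
      in parallel⇒Θ k p′m p′a mb p′b (ma p′m mq) ◅◅ (inj₁ (square p′m mq mb) ◅ ε)
      where
      p′b : d p′ b ≡ suc k
      p′b = ≤-antisym (subst (λ j → d p′ b ≤ suc j) p′a (d-stepʳ ab p′))
                      (≤-pred (subst (_≤ suc (d p′ b)) pb (d-stepˡ pp′ b)))
      p′q≡2 : d p′ q ≡ 2
      p′q≡2 = ≤-antisym (d-minimal (step (adj-sym pp′) (step pq here)))
                        (subst (2 ≤_) (d-sym q p′) (+-cancelʳ-≤ k 2 (d q p′) (begin
                          2 + k            ≡⟨ qa ⟨
                          d q a            ≤⟨ d-triangle q p′ a ⟩
                          d q p′ + d p′ a  ≡⟨ cong (d q p′ +_) p′a ⟩
                          d q p′ + k       ∎)))
        where open ≤-Reasoning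
      ma : ∀ {m} → Adj p′ m → Adj m q → d m a ≡ suc k
      ma {m} p′m mq = ≤-antisym (subst (λ j → d m a ≤ suc j) p′a (d-stepˡ (adj-sym p′m) a))
                                (≤-pred (subst (_≤ suc (d m a)) qa (d-stepˡ (adj-sym mq) a)))
      square : ∀ {m} → Adj p′ m → Adj m q → d m b ≡ k → Θ₀ Adj (p′ , m) (p , q)
      square p′m mq mb = p′m , mq , adj-sym pq , pp′ , (λ { refl → m≢1+n+m k (trans (sym p′a) qa) })
                                                     , (λ { refl → m≢1+n+m k (trans (sym mb) pb) })

    crossing⇒Θ : Adj p q → d p a < d p b → ¬ (d q a < d q b) → Θ Adj (a , b) (p , q)
    crossing⇒Θ {p} {q} pq p-closer q-farther = parallel⇒Θ (d p a) pq refl qb≡pa pb qa′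
      where
      pb : d p b ≡ suc (d p a)
      pb = closer⇒d≡suc ab p-closer
      qa : d q a ≡ suc (d q b)
      qa = ≮⇒d≡suc ab q-farther
      qb≡pa : d q b ≡ d p a
      qb≡pa = ≤-antisym (≤-pred (subst₂ _≤_ qa refl (d-stepˡ (adj-sym pq) a)))
                        (≤-pred (subst₂ _≤_ pb refl (d-stepˡ pq b)))
      qa′ : d q a ≡ suc (d p a)
      qa′ = trans qa (cong suc qb≡pa)

    ConnAvoid⇒closer : ConnAvoid Adj (a , b) u v → d u a < d u b → d v a < d v b
    ConnAvoid⇒closer ε u-closer = u-closer
    ConnAvoid⇒closer (_◅_ {j = w} (uw , ¬Θ) rest) u-closer with d w a <? d w b
    ... | yes w-closer  = ConnAvoid⇒closer rest w-closer
    ... | no  w-farther = ⊥-elim (¬Θ (crossing⇒Θ uw u-closer w-farther))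

    closer⇒InLadder : d x b < d x a → InLadder Adj (a , b) a x
    closer⇒InLadder {x} x-closer = separates , b , ab , ε
      where
      a-closer : d a a < d a b
      a-closer = subst₂ _<_ (sym (d-refl a)) (sym (adj⇒d≡1 ab)) z<s
      separates : Separates Adj (a , b) a x
      separates conn = <-asym (ConnAvoid⇒closer conn a-closer) x-closer

  disjoint-ladders⇒between :
    (∀ a b → Adj a b → InLadder Adj (a , b) v0 v → InLadder Adj (a , b) v0 u → ⊥) → InI d v u v0
  disjoint-ladders⇒between {v0} {v} {u} disjoint with median-of v0 v u
  ... | m , v0vm , vum , uv0m with m ≟ v0
  ... | yes refl = vum
  ... | no m≢v0 =
    let (w , v0w , w-closer) = step-toward (λ v0≡m → m≢v0 (sym v0≡m))
        v0w-in-ladder : ∀ {x} → InI d x v0 m → InLadder Adj (v0 , w) v0 x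
        v0w-in-ladder x-side = closer⇒InLadder v0w (closer-through-interval x-side w-closer)
    in ⊥-elim (disjoint v0 w v0w (v0w-in-ladder (InI-sym v0vm)) (v0w-in-ladder uv0m))

lemma19 : (n : ℕ) → 3 ≤ n → (Adj : Rel n) → IsSimple Adj →
    (d : Fin n → Fin n → ℕ) → IsShortestPathDist Adj d → IsMedian d →
    (ω : Fin n → ℕ) → MinorityCondition Adj →
    (v0 : Fin n) → InAllMajority Adj v0 →
    (umax : Fin n) → (∀ x → dω d ω v0 x ≤ dω d ω v0 umax) →
    ((∀ x → dω d ω v0 x ≤ dω d ω v0 v0) → umax ≡ v0) →
    umax ≢ v0 →
    (v : Fin n) →
    (∀ a b → Adj a b → InLadder Adj (a , b) v0 v → InLadder Adj (a , b) v0 umax → ⊥) →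
    (ecc d ω v ≡ d v v0 + dω d ω v0 umax) × (d v v0 + dω d ω v0 umax ≡ dω d ω v umax)
lemma19 n _ Adj simple d shortest median ω _ v0 _ umax umax-max _ _ v disjoint =
  ecc-through ω umax-max v0-between , dω-through ω v0-between
  where
  open MedianGraphs Adj simple d shortest median
  v0-between : InI d v umax v0
  v0-between = disjoint-ladders⇒between disjoint
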